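{- Let $G=(X\cup Y,E)$ be a connected bipartite graph (with bipartition $X,Y$) having at least one vertex of odd degree in $X$ and at least one vertex of odd degree in $Y$. Let $V_{odd}$ be the set of odd-degree vertices of $G$. Then $E$ can be decomposed into exactly $|V_{odd}|/2$ open trails, at least one of which is an $XY$-trail.
   Context: A trail from $v_1$ to $v_{t+1}$ is a sequence of pairwise distinct edges $e_1,\ldots,e_t$ with $e_i=v_iv_{i+1}$; it is open if $v_1\neq v_{t+1}$. A decomposition of $E$ into trails is a partition of $E$ into the edge sets of trails. In a bipartite graph with bipartition $X\cup Y$, an $XY$-trail is an open trail with one end in $X$ and the other end in $Y$. -}

module Defs where

open import Data.Nat using (ℕ; _%_; _/_)
open import Data.Bool using (Bool; true; false)
open import Data.Fin using (Fin; _≟_)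
open import Data.Fin.Properties using ()
open import Data.Product using (_×_; _,_; proj₁; proj₂; Σ-syntax)
open import Data.Sum using (_⊎_)
open import Data.List using (List; []; _∷_; length; filter; concatMap; allFin; lookup)
open import Data.List.Membership.Propositional using (_∈_)
open import Data.List.Relation.Unary.All using (All)
open import Data.List.Relation.Unary.Any using (Any)
open import Data.List.Relation.Unary.Unique.Propositional using (Unique)
open import Data.List.Relation.Binary.Permutation.Propositional using (_↭_)
open import Relation.Binary.PropositionalEquality using (_≡_; _≢_)
open import Relation.Nullary.Decidable using (_⊎-dec_)

-- A finite simple bipartite graph on vertex set Fin n.
-- side v = false means v ∈ X, side v = true means v ∈ Y.
record BipGraph (n : ℕ) : Set where
  field
    side     : Fin n → Bool
    edges    : List (Fin n × Fin n)
    bip      : All (λ e → side (proj₁ e) ≡ false × side (proj₂ e) ≡ true) edges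
    simple   : Unique edges

module _ {n : ℕ} (G : BipGraph n) where
  open BipGraph G

  Edge : Set
  Edge = Fin (length edges)

  edge : Edge → Fin n × Fin n
  edge = lookup edges

  Joins : Fin n × Fin n → Fin n → Fin n → Set
  Joins e u w = (proj₁ e ≡ u × proj₂ e ≡ w) ⊎ (proj₂ e ≡ u × proj₁ e ≡ w)

  degree : Fin n → ℕ
  degree v = length (filter (λ e → (proj₁ e ≟ v) ⊎-dec (proj₂ e ≟ v)) edges)

  Vodd : List (Fin n)
  Vodd = filter (λ v → degree v % 2 ≟ℕ 1) (allFin n)
    where open import Data.Nat using () renaming (_≟_ to _≟ℕ_)

  data Reach : Fin n → Fin n → Set where
    here  : ∀ {v} → Reach v v
    step  : ∀ {u w v} (e : Edge) → Joins (edge e) u w → Reach w v → Reach u v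

  Connected : Set
  Connected = ∀ u v → Reach u v

  data Walk : Fin n → Fin n → List Edge → Set where
    nil  : ∀ {v} → Walk v v []
    cons : ∀ {u w v es} (e : Edge) → Joins (edge e) u w → Walk w v es → Walk u v (e ∷ es)

  record OpenTrail : Set where
    field
      start  : Fin n
      end    : Fin n
      tedges : List Edge
      walk   : Walk start end tedges
      distinct : Unique tedges
      open′  : start ≢ end

  IsXYTrail : OpenTrail → Set
  IsXYTrail T = side (OpenTrail.start T) ≢ side (OpenTrail.end T)

  -- a decomposition of E into trails: the edge sets partition E
  -- (every edge occurs in exactly one trail, exactly once)
  IsDecomposition : List OpenTrail → Set
  IsDecomposition Ts = concatMap OpenTrail.tedges Ts ↭ allFin (length edges)

  OddOnBothSides : Set
  OddOnBothSides =
    Σ[ x ∈ Fin n ] (side x ≡ false × degree x % 2 ≡ 1) ×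
    Σ[ y ∈ Fin n ] (side y ≡ true × degree y % 2 ≡ 1)

-- Start from the decomposition of E into its edges, viewed as one-edge open trails: each vertex v is
-- then an end of exactly deg v trails. While some vertex is an end of two trails, splice them there;
-- the result is an open trail, or a closed one if their far ends also coincide. Either way the
-- number of trail ends at every vertex keeps its parity and the total number of ends drops, so we
-- arrive at a decomposition in which every odd vertex is an end of exactly one open trail and no
-- even vertex is an end at all; the open trails are then |V_odd|/2 in number. Connectivity lets each
-- closed trail be inserted into an open one at a common vertex. Finally, if no open trail is an
-- XY-trail, each one has both ends in X or both in Y; odd vertices on both sides give trails of both
-- kinds, connectivity gives a vertex w lying on an XX-trail and on a YY-trail, and exchanging their
-- tails at w yields two XY-trails. Edge-distinctness within a trail is never tracked: it follows at
-- the end because the edge lists of all trails together are a permutation of E.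

module Submission where

open import Defs
import Algebra.Solver.CommutativeMonoid as CommutativeMonoidSolver
open import Data.Bool using (Bool; true; false)
import Data.Bool as Bool
open import Data.Empty using (⊥-elim)
open import Data.Fin using (Fin; _≟_)
open import Data.List using (List; []; _∷_; _++_; [_]; length; filter; concatMap; map; reverse; reverseAcc; allFin)
open import Data.List.Properties
  using (filter-++; length-++; length-++-≤ʳ; concatMap-++; concatMap-map; ++-assoc; ++-identityʳ; map-tabulate; tabulate-lookup)
open import Data.List.Membership.Propositional using (_∈_; _∉_)
open import Data.List.Membership.Propositional.Properties
  using (∈-∃++; ∈-concatMap⁻; ∈-++⁺ˡ; ∈-++⁻; ∈-allFin; ∈-filter⁺; ∈-filter⁻; ∈-lookup)
import Data.List.Membership.DecPropositional as DecMembership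
open import Data.List.Relation.Binary.Permutation.Propositional
  using (_↭_; ↭-refl; ↭-reflexive; ↭-sym; ↭-trans; ↭-prep; ↭-swap; ↭⇒↭ₛ; module PermutationReasoning)
import Data.List.Relation.Binary.Permutation.Propositional as Perm
open import Data.List.Relation.Binary.Permutation.Propositional.Properties
  using (↭-length; ↭-reverse; filter-↭; shift; shifts; ++⁺ˡ; ++⁺ʳ; ++⁺; ∈-resp-↭; All-resp-↭; ++-commutativeMonoid)
import Data.List.Relation.Binary.Permutation.Setoid.Properties as Permₛ
open import Data.List.Relation.Unary.All using (All; []; _∷_)
import Data.List.Relation.Unary.All as All
import Data.List.Relation.Unary.All.Properties as AllP
open import Data.List.Relation.Unary.AllPairs using ([]; _∷_)
open import Data.List.Relation.Unary.Any using (Any; here; there)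
open import Data.List.Relation.Unary.Unique.Propositional using (Unique)
import Data.List.Relation.Unary.Unique.Propositional.Properties as Unique
open import Data.Nat using (ℕ; suc; _+_; _*_; _%_; _/_; _<_; s≤s)
import Data.Nat as ℕ
open import Data.Nat.DivMod using ([m+kn]%n≡m%n; m*n/n≡m)
open import Data.Nat.Properties using (suc-injective; 0≢1+n; <-≤-trans; ≤-refl; ≤-reflexive; module ≤-Reasoning)
open import Data.Nat.Solver using (module +-*-Solver)
open import Data.Product using (Σ-syntax; _×_; _,_; proj₁; proj₂)
open import Data.Sum using (_⊎_; inj₁; inj₂; [_,_]′)
open import Function using (_∘_; id)
open import Function.Bundles using (_⇔_; mk⇔; Equivalence)
open import Relation.Binary.Definitions using (DecidableEquality)
open import Relation.Binary.PropositionalEquality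
  using (_≡_; _≢_; refl; sym; trans; cong; cong₂; subst; setoid; module ≡-Reasoning)
open import Relation.Nullary using (Dec; yes; no; ¬_)
open import Relation.Nullary.Decidable using (_⊎-dec_)
open import Relation.Unary using (Decidable)

open module DecFinMembership {k : ℕ} = DecMembership (_≟_ {k}) using (_∈?_)

-- Lists, permutations and multiplicities

private variable
  A B : Set
  x : A
  xs ys : List A

select : {P : A → Set} → Any P xs → Σ[ y ∈ A ] Σ[ rest ∈ List A ] (xs ↭ y ∷ rest × P y)
select (here p) = _ , _ , ↭-refl , p
select {xs = x ∷ _} (there any) with select any
... | y , rest , xs↭ , p = y , x ∷ rest , ↭-trans (↭-prep x xs↭) (↭-swap x y ↭-refl) , p

select-concatMap : (f : A → List B) (xs : List A) {y : B} → y ∈ concatMap f xs →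
  Σ[ x ∈ A ] Σ[ rest ∈ List A ] (xs ↭ x ∷ rest × y ∈ f x)
select-concatMap f xs y∈ = select (∈-concatMap⁻ f {xs = xs} y∈)

concatMap-↭ : (f : A → List B) → xs ↭ ys → concatMap f xs ↭ concatMap f ys
concatMap-↭ f Perm.refl = ↭-refl
concatMap-↭ f (Perm.prep x p) = ++⁺ˡ (f x) (concatMap-↭ f p)
concatMap-↭ f (Perm.swap x y p) = ↭-trans (shifts (f x) (f y)) (++⁺ˡ (f y) (++⁺ˡ (f x) (concatMap-↭ f p)))
concatMap-↭ f (Perm.trans p q) = ↭-trans (concatMap-↭ f p) (concatMap-↭ f q)

Unique-resp-↭ : xs ↭ ys → Unique xs → Unique ys
Unique-resp-↭ p = Permₛ.Unique-resp-↭ (setoid _) (↭⇒↭ₛ p)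

Unique-++⁻ˡ : ∀ xs → Unique (xs ++ ys) → Unique xs
Unique-++⁻ˡ [] _ = []
Unique-++⁻ˡ (x ∷ xs) (x∉ ∷ u) = AllP.++⁻ˡ xs x∉ ∷ Unique-++⁻ˡ xs u

Unique-++⁻ʳ : ∀ xs → Unique (xs ++ ys) → Unique ys
Unique-++⁻ʳ [] u = u
Unique-++⁻ʳ (x ∷ xs) (_ ∷ u) = Unique-++⁻ʳ xs u

Unique-++-disjoint : ∀ xs → Unique (xs ++ ys) → x ∈ xs → x ∉ ys
Unique-++-disjoint (x ∷ xs) (x∉ ∷ _) (here refl) = AllP.All¬⇒¬Any (AllP.++⁻ʳ xs x∉)
Unique-++-disjoint (_ ∷ xs) (_ ∷ u) (there x∈) = Unique-++-disjoint xs u x∈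

[]⊎∈ : ∀ (xs : List A) → xs ≡ [] ⊎ Σ[ x ∈ A ] x ∈ xs
[]⊎∈ [] = inj₁ refl
[]⊎∈ (x ∷ _) = inj₂ (x , here refl)

PairReduction : List A → List A → Set
PairReduction {A} xs ys = Σ[ rs ∈ List A ] Σ[ r ∈ A ] xs ↭ (r ∷ rs) ++ (r ∷ rs) ++ ys

PairReduction⇒length< : PairReduction xs ys → length ys < length xs
PairReduction⇒length< {xs = xs} {ys = ys} (rs , r , p) = begin-strict
  length ys                             ≤⟨ length-++-≤ʳ ys {r ∷ rs} ⟩
  length ((r ∷ rs) ++ ys)               <⟨ s≤s (length-++-≤ʳ _ {rs}) ⟩
  length ((r ∷ rs) ++ (r ∷ rs) ++ ys)   ≡⟨ ↭-length (↭-sym p) ⟩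
  length xs                             ∎
  where open ≤-Reasoning

module Multiplicity {A : Set} (_≟_ : DecidableEquality A) where

  open DecMembership _≟_ using () renaming (_∈?_ to _∈?ₘ_)

  count : A → List A → ℕ
  count v xs = length (filter (_≟ v) xs)

  count-++ : ∀ v xs ys → count v (xs ++ ys) ≡ count v xs + count v ys
  count-++ v xs ys = trans (cong length (filter-++ (_≟ v) xs ys)) (length-++ (filter (_≟ v) xs))

  count-↭ : ∀ v {xs ys} → xs ↭ ys → count v xs ≡ count v ys
  count-↭ v p = ↭-length (filter-↭ (_≟ v) p)

  count≢0⇒∈ : ∀ {v} xs → count v xs ≢ 0 → v ∈ xs
  count≢0⇒∈ [] c≢0 = ⊥-elim (c≢0 refl)
  count≢0⇒∈ {v} (x ∷ xs) c≢0 with x ≟ v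
  ... | yes refl = here refl
  ... | no _ = there (count≢0⇒∈ xs c≢0)

  ∉⇒count≡0 : ∀ {v} xs → v ∉ xs → count v xs ≡ 0
  ∉⇒count≡0 [] _ = refl
  ∉⇒count≡0 {v} (x ∷ xs) v∉ with x ≟ v
  ... | yes refl = ⊥-elim (v∉ (here refl))
  ... | no _ = ∉⇒count≡0 xs (λ v∈ → v∉ (there v∈))

  Unique⇒count≡1 : ∀ {v} xs → Unique xs → v ∈ xs → count v xs ≡ 1
  Unique⇒count≡1 {v} (x ∷ xs) (x∉ ∷ u) v∈ with x ≟ v | v∈
  ... | yes refl | _ = cong suc (∉⇒count≡0 xs (AllP.All¬⇒¬Any x∉))
  ... | no x≢v | here v≡x = ⊥-elim (x≢v (sym v≡x))
  ... | no _ | there v∈xs = Unique⇒count≡1 xs u v∈xs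

  count-∷-cancel : ∀ v x {xs ys} → count v (x ∷ xs) ≡ count v (x ∷ ys) → count v xs ≡ count v ys
  count-∷-cancel v x eq with x ≟ v
  ... | yes _ = suc-injective eq
  ... | no _ = eq

  count-∷-self : ∀ x xs → count x (x ∷ xs) ≡ suc (count x xs)
  count-∷-self x xs with x ≟ x
  ... | yes _ = refl
  ... | no x≢x = ⊥-elim (x≢x refl)

  count-∷-≢ : ∀ {x v xs} → x ≢ v → count v (x ∷ xs) ≡ count v xs
  count-∷-≢ {x} {v} x≢v with x ≟ v
  ... | yes x≡v = ⊥-elim (x≢v x≡v)
  ... | no _ = refl

  ↭-by-count : ∀ xs ys → (∀ v → count v xs ≡ count v ys) → xs ↭ ys
  ↭-by-count [] [] _ = ↭-refl
  ↭-by-count [] (y ∷ ys) eq = ⊥-elim (0≢1+n (trans (eq y) (count-∷-self y ys)))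
  ↭-by-count (x ∷ xs) ys eq with ∈-∃++ (count≢0⇒∈ ys x∈ys)
    where
    x∈ys : count x ys ≢ 0
    x∈ys c≡0 = 0≢1+n (trans (sym c≡0) (trans (sym (eq x)) (count-∷-self x xs)))
  ... | pre , post , refl =
    ↭-trans (↭-prep x (↭-by-count xs (pre ++ post) eq′)) (↭-sym (shift x pre post))
    where
    eq′ : ∀ v → count v xs ≡ count v (pre ++ post)
    eq′ v = count-∷-cancel v x (trans (eq v) (count-↭ v (shift x pre post)))

  Unique-∈⇔⇒↭ : ∀ {xs ys} → Unique xs → Unique ys → (∀ v → v ∈ xs ⇔ v ∈ ys) → xs ↭ ys
  Unique-∈⇔⇒↭ {xs} {ys} uxs uys same = ↭-by-count xs ys counts
    where
    counts : ∀ v → count v xs ≡ count v ys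
    counts v with v ∈?ₘ xs
    ... | yes v∈ = trans (Unique⇒count≡1 xs uxs v∈) (sym (Unique⇒count≡1 ys uys (Equivalence.to (same v) v∈)))
    ... | no v∉ = trans (∉⇒count≡0 xs v∉) (sym (∉⇒count≡0 ys (λ v∈ → v∉ (Equivalence.from (same v) v∈))))

  PairReduction⇒count%2 : ∀ {xs ys} → PairReduction xs ys → ∀ v → count v xs % 2 ≡ count v ys % 2
  PairReduction⇒count%2 {xs} {ys} (rs′ , r , p) v = begin
    count v xs % 2                                 ≡⟨ cong (_% 2) (count-↭ v p) ⟩
    count v (rs ++ rs ++ ys) % 2                   ≡⟨ cong (_% 2) (twice-rs) ⟩
    (count v ys + count v rs * 2) % 2              ≡⟨ [m+kn]%n≡m%n (count v ys) (count v rs) 2 ⟩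
    count v ys % 2                                 ∎
    where
    rs = r ∷ rs′
    open ≡-Reasoning
    open +-*-Solver using (solve; _:+_; _:*_; _:=_; con)
    twice-rs : count v (rs ++ rs ++ ys) ≡ count v ys + count v rs * 2
    twice-rs = begin
      count v (rs ++ rs ++ ys)               ≡⟨ count-++ v rs (rs ++ ys) ⟩
      count v rs + count v (rs ++ ys)        ≡⟨ cong (count v rs +_) (count-++ v rs ys) ⟩
      count v rs + (count v rs + count v ys) ≡⟨ solve 2 (λ r y → r :+ (r :+ y) := y :+ r :* con 2) refl (count v rs) (count v ys) ⟩
      count v ys + count v rs * 2            ∎

  count-flattened-pairs : ∀ (ps : List (A × A)) → All (λ p → proj₁ p ≢ proj₂ p) ps → ∀ v →
    length (filter (λ p → (proj₁ p ≟ v) ⊎-dec (proj₂ p ≟ v)) ps)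
      ≡ count v (concatMap (λ p → proj₁ p ∷ proj₂ p ∷ []) ps)
  count-flattened-pairs [] [] v = refl
  count-flattened-pairs ((a , b) ∷ ps) (a≢b ∷ ps-ok) v with a ≟ v | b ≟ v
  ... | yes refl | yes refl = ⊥-elim (a≢b refl)
  ... | yes refl | no b≢a =
    cong suc (trans (count-flattened-pairs ps ps-ok a) (sym (count-∷-≢ b≢a)))
  ... | no a≢v | yes refl =
    trans (cong suc (count-flattened-pairs ps ps-ok b)) (sym (count-∷-self b _))
  ... | no a≢v | no b≢v =
    trans (count-flattened-pairs ps ps-ok v) (sym (count-∷-≢ b≢v))


module _ {k : ℕ} {xs ys : List (Fin k)} (xs++ys↭ : xs ++ ys ↭ allFin k) where

  ∈ˡ⇒∉ʳ : ∀ {i} → i ∈ xs → i ∉ ys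
  ∈ˡ⇒∉ʳ = Unique-++-disjoint xs (Unique-resp-↭ (↭-sym xs++ys↭) (Unique.allFin⁺ k))

  ∉ˡ⇒∈ʳ : ∀ {i} → i ∉ xs → i ∈ ys
  ∉ˡ⇒∈ʳ {i} i∉xs with ∈-++⁻ xs (∈-resp-↭ (↭-sym xs++ys↭) (∈-allFin i))
  ... | inj₁ i∈xs = ⊥-elim (i∉xs i∈xs)
  ... | inj₂ i∈ys = i∈ys

-- Walks in a bipartite graph

module _ {n : ℕ} (G : BipGraph n) where
  open BipGraph G using (side; edges; bip)
  open Multiplicity (_≟_ {n})
  module EdgePerm = CommutativeMonoidSolver (++-commutativeMonoid {A = Edge G})
  module VertexPerm = CommutativeMonoidSolver (++-commutativeMonoid {A = Fin n})

  endX endY : Edge G → Fin n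
  endX e = proj₁ (edge G e)
  endY e = proj₂ (edge G e)

  allEdges : List (Edge G)
  allEdges = allFin (length edges)

  Incident : Edge G → Fin n → Set
  Incident e v = endX e ≡ v ⊎ endY e ≡ v

  joins-sym : ∀ {p u w} → Joins G p u w → Joins G p w u
  joins-sym (inj₁ (p , q)) = inj₂ (q , p)
  joins-sym (inj₂ (p , q)) = inj₁ (q , p)

  joins⇒incidentˡ : ∀ {e u w} → Joins G (edge G e) u w → Incident e u
  joins⇒incidentˡ (inj₁ (p , _)) = inj₁ p
  joins⇒incidentˡ (inj₂ (p , _)) = inj₂ p

  joins⇒incidentʳ : ∀ {e u w} → Joins G (edge G e) u w → Incident e w
  joins⇒incidentʳ j = joins⇒incidentˡ (joins-sym j)

  joins-incident : ∀ {e u u′ w} → Joins G (edge G e) u u′ → Incident e w → u ≡ w ⊎ u′ ≡ w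
  joins-incident (inj₁ (refl , refl)) (inj₁ refl) = inj₁ refl
  joins-incident (inj₁ (refl , refl)) (inj₂ refl) = inj₂ refl
  joins-incident (inj₂ (refl , refl)) (inj₁ refl) = inj₂ refl
  joins-incident (inj₂ (refl , refl)) (inj₂ refl) = inj₁ refl

  walk-++ : ∀ {s t u p q} → Walk G s t p → Walk G t u q → Walk G s u (p ++ q)
  walk-++ nil w = w
  walk-++ (cons e j w) w′ = cons e j (walk-++ w w′)

  -- reverse = reverseAcc [], so the accumulating form needs no rewriting.
  walk-reverseAcc : ∀ {s t u es acc} → Walk G s t es → Walk G s u acc → Walk G t u (reverseAcc acc es)
  walk-reverseAcc nil w′ = w′
  walk-reverseAcc (cons e j w) w′ = walk-reverseAcc w (cons e (joins-sym j) w′)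

  walk-reverse : ∀ {s t es} → Walk G s t es → Walk G t s (reverse es)
  walk-reverse w = walk-reverseAcc w nil

  walk-first-edge : ∀ {s t es} → Walk G s t es → s ≢ t → Σ[ e ∈ Edge G ] e ∈ es × Incident e s
  walk-first-edge nil s≢t = ⊥-elim (s≢t refl)
  walk-first-edge (cons e j _) _ = e , here refl , joins⇒incidentˡ j

  record SplitAt (s t w : Fin n) (es : List (Edge G)) : Set where
    constructor splitAt
    field
      before after : List (Edge G)
      es≡          : es ≡ before ++ after
      toMid        : Walk G s w before
      fromMid      : Walk G w t after

  walk-split : ∀ {s t es e w} → Walk G s t es → e ∈ es → Incident e w → SplitAt s t w es
  walk-split (cons e j wk) (here refl) inc with joins-incident j inc
  ... | inj₁ refl = splitAt [] (e ∷ _) refl nil (cons e j wk)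
  ... | inj₂ refl = splitAt [ e ] _ refl (cons e j nil) wk
  walk-split (cons e j wk) (there e∈) inc with walk-split wk e∈ inc
  ... | splitAt p q refl w₁ w₂ = splitAt (e ∷ p) q refl (cons e j w₁) w₂

  EdgeAt : (Edge G → Set) → Fin n → Set
  EdgeAt P v = Σ[ e ∈ Edge G ] P e × Incident e v

  mixed-vertex : ∀ {P : Edge G → Set} → Decidable P → ∀ {u v} → Reach G u v →
    EdgeAt P u → EdgeAt (¬_ ∘ P) v → Σ[ w ∈ Fin n ] EdgeAt P w × EdgeAt (¬_ ∘ P) w
  mixed-vertex P? here atP at¬P = _ , atP , at¬P
  mixed-vertex P? (step e j r) atP at¬P with P? e
  ... | yes Pe = mixed-vertex P? r (e , Pe , joins⇒incidentʳ j) at¬P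
  ... | no ¬Pe = _ , atP , (e , ¬Pe , joins⇒incidentˡ j)

  meetingVertex : ∀ {xs ys u v} → xs ++ ys ↭ allEdges → Reach G u v →
    EdgeAt (_∈ xs) u → EdgeAt (_∈ ys) v → Σ[ w ∈ Fin n ] EdgeAt (_∈ xs) w × EdgeAt (_∈ ys) w
  meetingVertex {xs} xs++ys↭ r atX (e , e∈ys , at) =
    let w , atX′ , (g , g∉xs , g-at) = mixed-vertex (_∈? xs) r atX (e , (λ e∈xs → ∈ˡ⇒∉ʳ xs++ys↭ e∈xs e∈ys) , at)
    in w , atX′ , (g , ∉ˡ⇒∈ʳ xs++ys↭ g∉xs , g-at)

  -- Decompositions of E into open and closed walks

  record OpenWalk : Set where
    constructor openWalk
    field
      src dst  : Fin n
      route    : List (Edge G)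
      walk     : Walk G src dst route
      src≢dst  : src ≢ dst

  record ClosedWalk : Set where
    constructor closedWalk
    field
      base  : Fin n
      route : List (Edge G)
      walk  : Walk G base base route

  open OpenWalk

  endpoints : OpenWalk → List (Fin n)
  endpoints T = src T ∷ dst T ∷ []

  allEndpoints : List OpenWalk → List (Fin n)
  allEndpoints = concatMap endpoints

  openEdges : List OpenWalk → List (Edge G)
  openEdges = concatMap route

  closedEdges : List ClosedWalk → List (Edge G)
  closedEdges = concatMap ClosedWalk.route

  edgeAtSrc : ∀ {os T R} → os ↭ T ∷ R → EdgeAt (_∈ openEdges os) (src T)
  edgeAtSrc {T = T} os↭ =
    let e , e∈T , at = walk-first-edge (walk T) (src≢dst T)
    in e , ∈-resp-↭ (↭-sym (concatMap-↭ route os↭)) (∈-++⁺ˡ e∈T) , at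

  splitOpenAt : ∀ os {w} → EdgeAt (_∈ openEdges os) w →
    Σ[ T ∈ OpenWalk ] Σ[ R ∈ List OpenWalk ] os ↭ T ∷ R × SplitAt (src T) (dst T) w (route T)
  splitOpenAt os (e , e∈ , at) =
    let T , R , os↭ , e∈T = select-concatMap route os e∈
    in T , R , os↭ , walk-split (walk T) e∈T at

  splitClosedAt : ∀ cs {w} → EdgeAt (_∈ closedEdges cs) w →
    Σ[ Z ∈ ClosedWalk ] Σ[ R ∈ List ClosedWalk ] cs ↭ Z ∷ R × SplitAt (ClosedWalk.base Z) (ClosedWalk.base Z) w (ClosedWalk.route Z)
  splitClosedAt cs (e , e∈ , at) =
    let Z , R , cs↭ , e∈Z = select-concatMap ClosedWalk.route cs e∈
    in Z , R , cs↭ , walk-split (ClosedWalk.walk Z) e∈Z at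

  reverseWalk : OpenWalk → OpenWalk
  reverseWalk (openWalk s t es w s≢t) = openWalk t s (reverse es) (walk-reverse w) (s≢t ∘ sym)

  infix 4 _≃_
  record _≃_ (T T′ : OpenWalk) : Set where
    constructor mk≃
    field
      endpoints↭ : endpoints T ↭ endpoints T′
      route↭     : route T ↭ route T′

  ≃-refl : ∀ {T} → T ≃ T
  ≃-refl = mk≃ ↭-refl ↭-refl

  ≃-reverseWalk : ∀ T → T ≃ reverseWalk T
  ≃-reverseWalk T = mk≃ (↭-swap (src T) (dst T) ↭-refl) (↭-sym (↭-reverse (route T)))

  endingAt : ∀ T {v} → v ∈ endpoints T → Σ[ T′ ∈ OpenWalk ] dst T′ ≡ v × T ≃ T′
  endingAt T (here refl) = reverseWalk T , refl , ≃-reverseWalk T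
  endingAt T (there (here refl)) = T , refl , ≃-refl

  startingAt : ∀ T {v} → v ∈ endpoints T → Σ[ T′ ∈ OpenWalk ] src T′ ≡ v × T ≃ T′
  startingAt T (here refl) = T , refl , ≃-refl
  startingAt T (there (here refl)) = reverseWalk T , refl , ≃-reverseWalk T

  infix 4 _≋_
  record _≋_ (os os′ : List OpenWalk) : Set where
    constructor mk≋
    field
      allEndpoints↭ : allEndpoints os ↭ allEndpoints os′
      openEdges↭    : openEdges os ↭ openEdges os′
  open _≋_

  ≋-refl : ∀ {os} → os ≋ os
  ≋-refl = mk≋ ↭-refl ↭-refl

  ≋-sym : ∀ {os os′} → os ≋ os′ → os′ ≋ os
  ≋-sym (mk≋ e r) = mk≋ (↭-sym e) (↭-sym r)

  ≋-trans : ∀ {os os′ os″} → os ≋ os′ → os′ ≋ os″ → os ≋ os″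
  ≋-trans (mk≋ e r) (mk≋ e′ r′) = mk≋ (↭-trans e e′) (↭-trans r r′)

  ↭⇒≋ : ∀ {os os′} → os ↭ os′ → os ≋ os′
  ↭⇒≋ p = mk≋ (concatMap-↭ endpoints p) (concatMap-↭ route p)

  ∷-≋ : ∀ {T T′ os os′} → T ≃ T′ → os ≋ os′ → T ∷ os ≋ T′ ∷ os′
  ∷-≋ (mk≃ e r) (mk≋ es rs) = mk≋ (++⁺ e es) (++⁺ r rs)

  record Decomposition : Set where
    field
      opens      : List OpenWalk
      closeds    : List ClosedWalk
      partitions : openEdges opens ++ closedEdges closeds ↭ allEdges

  open Decomposition

  -- Splicing walks that share an end

  SharedEnd : List OpenWalk → Set
  SharedEnd os = Σ[ v ∈ Fin n ] Σ[ T₁ ∈ OpenWalk ] Σ[ T₂ ∈ OpenWalk ] Σ[ R ∈ List OpenWalk ]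
    os ↭ T₁ ∷ T₂ ∷ R × v ∈ endpoints T₁ × v ∈ endpoints T₂

  sharedEnd-∷ : ∀ T {v R} → v ∈ endpoints T → v ∈ allEndpoints R → SharedEnd (T ∷ R)
  sharedEnd-∷ T v∈T v∈R with select-concatMap endpoints _ v∈R
  ... | T₂ , R′ , R↭ , v∈T₂ = _ , T , T₂ , R′ , ↭-prep T R↭ , v∈T , v∈T₂

  Unique⊎SharedEnd : ∀ os → Unique (allEndpoints os) ⊎ SharedEnd os
  Unique⊎SharedEnd [] = inj₁ []
  Unique⊎SharedEnd (T ∷ R) with Unique⊎SharedEnd R
  ... | inj₂ (v , T₁ , T₂ , R′ , R↭ , v∈₁ , v∈₂) = inj₂ (v , T₁ , T₂ , T ∷ R′ , T∷R↭ , v∈₁ , v∈₂)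
    where
    T∷R↭ : T ∷ R ↭ T₁ ∷ T₂ ∷ T ∷ R′
    T∷R↭ = ↭-trans (↭-prep T R↭) (↭-trans (↭-swap T T₁ ↭-refl) (↭-prep T₁ (↭-swap T T₂ ↭-refl)))
  ... | inj₁ uniqueR with src T ∈? allEndpoints R | dst T ∈? allEndpoints R
  ... | yes s∈ | _ = inj₂ (sharedEnd-∷ T (here refl) s∈)
  ... | no _ | yes d∈ = inj₂ (sharedEnd-∷ T (there (here refl)) d∈)
  ... | no s∉ | no d∉ = inj₁ ((src≢dst T ∷ AllP.¬Any⇒All¬ _ s∉) ∷ AllP.¬Any⇒All¬ _ d∉ ∷ uniqueR)

  joinWalks : ∀ A B → dst A ≡ src B → Walk G (src A) (dst B) (route A ++ route B)
  joinWalks A B eq = walk-++ (walk A) (subst (λ u → Walk G u (dst B) (route B)) (sym eq) (walk B))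

  spliceSharedEnd : (C : Decomposition) → SharedEnd (opens C) →
    Σ[ C′ ∈ Decomposition ] PairReduction (allEndpoints (opens C)) (allEndpoints (opens C′))
  spliceSharedEnd C (_ , T₁ , T₂ , R , os↭ , v∈₁ , v∈₂) with endingAt T₁ v∈₁ | startingAt T₂ v∈₂
  ... | A , refl , T₁≃A | B , srcB≡dstA , T₂≃B = spliced (src A ≟ dst B)
    where
    os≋ : opens C ≋ A ∷ B ∷ R
    os≋ = ≋-trans (↭⇒≋ os↭) (∷-≋ T₁≃A (∷-≋ T₂≃B ≋-refl))

    AB : Walk G (src A) (dst B) (route A ++ route B)
    AB = joinWalks A B (sym srcB≡dstA)

    spliced : Dec (src A ≡ dst B) →
      Σ[ C′ ∈ Decomposition ] PairReduction (allEndpoints (opens C)) (allEndpoints (opens C′))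
    spliced (yes closes) = record { opens = R ; closeds = cycle ∷ closeds C ; partitions = ↭-trans edges↭ (partitions C) }
                         , [ src A ] , dst A , ends↭
      where
      cycle : ClosedWalk
      cycle = closedWalk (src A) (route A ++ route B) (subst (λ u → Walk G (src A) u (route A ++ route B)) (sym closes) AB)
      edges↭ : openEdges R ++ closedEdges (cycle ∷ closeds C) ↭ openEdges (opens C) ++ closedEdges (closeds C)
      edges↭ = ↭-trans
        (solve 4 (λ a b r c → r ⊕ ((a ⊕ b) ⊕ c) ⊜ (a ⊕ (b ⊕ r)) ⊕ c) ↭-refl
               (route A) (route B) (openEdges R) (closedEdges (closeds C)))
        (++⁺ʳ (closedEdges (closeds C)) (↭-sym (openEdges↭ os≋)))
        where open EdgePerm using (solve; _⊕_; _⊜_)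
      ends↭ : allEndpoints (opens C) ↭ (dst A ∷ src A ∷ []) ++ (dst A ∷ src A ∷ []) ++ allEndpoints R
      ends↭ = ↭-trans (allEndpoints↭ os≋)
        (↭-trans (↭-reflexive (cong₂ (λ s d → src A ∷ dst A ∷ s ∷ d ∷ allEndpoints R) srcB≡dstA (sym closes)))
                 (↭-swap (src A) (dst A) ↭-refl))
    spliced (no open′) = record { opens = N ∷ R ; closeds = closeds C ; partitions = ↭-trans (++⁺ʳ _ edges↭) (partitions C) }
                       , [] , dst A , ends↭
      where
      N : OpenWalk
      N = openWalk (src A) (dst B) (route A ++ route B) AB open′
      edges↭ : openEdges (N ∷ R) ↭ openEdges (opens C)
      edges↭ = ↭-trans (↭-reflexive (++-assoc (route A) (route B) (openEdges R))) (↭-sym (openEdges↭ os≋))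
      ends↭ : allEndpoints (opens C) ↭ [ dst A ] ++ [ dst A ] ++ allEndpoints (N ∷ R)
      ends↭ = ↭-trans (allEndpoints↭ os≋)
        (↭-trans (↭-reflexive (cong (λ s → src A ∷ dst A ∷ s ∷ dst B ∷ allEndpoints R) srcB≡dstA))
                 (shifts [ src A ] (dst A ∷ dst A ∷ [])))

  spliceSharedEnds : ∀ k (C : Decomposition) → length (allEndpoints (opens C)) < k →
    Σ[ C′ ∈ Decomposition ] Unique (allEndpoints (opens C′))
      × (∀ v → count v (allEndpoints (opens C′)) % 2 ≡ count v (allEndpoints (opens C)) % 2)
  spliceSharedEnds (suc k) C (s≤s bound) with Unique⊎SharedEnd (opens C)
  ... | inj₁ unique = C , unique , λ _ → refl
  ... | inj₂ shared with spliceSharedEnd C shared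
  ... | C′ , reduction with spliceSharedEnds k C′ (<-≤-trans (PairReduction⇒length< reduction) bound)
  ... | C″ , unique , parity = C″ , unique , λ v → trans (parity v) (sym (PairReduction⇒count%2 reduction v))

  -- From single edges to walks ending exactly at the odd vertices

  edge-sides : ∀ e → side (endX e) ≡ false × side (endY e) ≡ true
  edge-sides e = All.lookup bip (∈-lookup e)

  opposite-sides⇒side≢ : ∀ {u w} → side u ≡ false → side w ≡ true → side u ≢ side w
  opposite-sides⇒side≢ su sw eq with trans (sym su) (trans eq sw)
  ... | ()

  opposite-sides⇒≢ : ∀ {u w} → side u ≡ false → side w ≡ true → u ≢ w
  opposite-sides⇒≢ su sw = opposite-sides⇒side≢ su sw ∘ cong side

  endX≢endY : ∀ e → endX e ≢ endY e
  endX≢endY e = opposite-sides⇒≢ (proj₁ (edge-sides e)) (proj₂ (edge-sides e))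

  edgeWalk : Edge G → OpenWalk
  edgeWalk e = openWalk (endX e) (endY e) [ e ] (cons e (inj₁ (refl , refl)) nil) (endX≢endY e)

  openEdges-edgeWalks : ∀ es → openEdges (map edgeWalk es) ≡ es
  openEdges-edgeWalks [] = refl
  openEdges-edgeWalks (e ∷ es) = cong (e ∷_) (openEdges-edgeWalks es)

  pairEnds : Fin n × Fin n → List (Fin n)
  pairEnds p = proj₁ p ∷ proj₂ p ∷ []

  map-edge-allEdges : map (edge G) allEdges ≡ edges
  map-edge-allEdges = trans (map-tabulate id (edge G)) (tabulate-lookup edges)

  allEndpoints-edgeWalks : allEndpoints (map edgeWalk allEdges) ≡ concatMap pairEnds edges
  allEndpoints-edgeWalks = begin
    concatMap endpoints (map edgeWalk allEdges)      ≡⟨ concatMap-map endpoints edgeWalk allEdges ⟩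
    concatMap (pairEnds ∘ edge G) allEdges           ≡⟨ concatMap-map pairEnds (edge G) allEdges ⟨
    concatMap pairEnds (map (edge G) allEdges)       ≡⟨ cong (concatMap pairEnds) map-edge-allEdges ⟩
    concatMap pairEnds edges                         ∎
    where open ≡-Reasoning

  degree≡count-pairEnds : ∀ v → degree G v ≡ count v (concatMap pairEnds edges)
  degree≡count-pairEnds = count-flattened-pairs edges (All.map (λ sides → opposite-sides⇒≢ (proj₁ sides) (proj₂ sides)) bip)

  edgeDecomposition : Decomposition
  edgeDecomposition = record
    { opens = map edgeWalk allEdges
    ; closeds = []
    ; partitions = ↭-reflexive (trans (++-identityʳ _) (openEdges-edgeWalks allEdges))
    }

  OddDegree? : Decidable (λ v → degree G v % 2 ≡ 1)
  OddDegree? v = degree G v % 2 ℕ.≟ 1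

  Unique-Vodd : Unique (Vodd G)
  Unique-Vodd = Unique.filter⁺ OddDegree? (Unique.allFin⁺ n)

  ∈Vodd⇔odd : ∀ v → v ∈ Vodd G ⇔ degree G v % 2 ≡ 1
  ∈Vodd⇔odd v = mk⇔ (proj₂ ∘ ∈-filter⁻ OddDegree? {xs = allFin n}) (∈-filter⁺ OddDegree? (∈-allFin v))

  endpoints↭Vodd : ∀ {E} → Unique E → (∀ v → count v E % 2 ≡ degree G v % 2) → E ↭ Vodd G
  endpoints↭Vodd {E} unique parity = Unique-∈⇔⇒↭ unique Unique-Vodd λ v → mk⇔
    (λ v∈E → Equivalence.from (∈Vodd⇔odd v) (trans (sym (parity v)) (cong (_% 2) (Unique⇒count≡1 E unique v∈E))))
    (λ v∈V → count≢0⇒∈ E λ c≡0 → 0≢1+n (trans (cong (_% 2) (sym c≡0)) (trans (parity v) (Equivalence.to (∈Vodd⇔odd v) v∈V))))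

  oddEndDecomposition : Σ[ C ∈ Decomposition ] allEndpoints (opens C) ↭ Vodd G
  oddEndDecomposition with spliceSharedEnds _ edgeDecomposition ≤-refl
  ... | C , unique , parity = C , endpoints↭Vodd unique λ v →
    trans (parity v) (cong (_% 2) (trans (cong (count v) allEndpoints-edgeWalks) (sym (degree≡count-pairEnds v))))

  -- Inserting closed walks and exchanging tails

  insertCycle : ∀ {w} T Z → SplitAt (src T) (dst T) w (route T) →
    SplitAt (ClosedWalk.base Z) (ClosedWalk.base Z) w (ClosedWalk.route Z) →
    Σ[ N ∈ OpenWalk ] endpoints N ≡ endpoints T × route N ↭ route T ++ ClosedWalk.route Z
  insertCycle T Z (splitAt p₁ q₁ route₁ w₁ w₂) (splitAt p₂ q₂ route₂ v₁ v₂) =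
    openWalk (src T) (dst T) (p₁ ++ (q₂ ++ p₂) ++ q₁) (walk-++ w₁ (walk-++ (walk-++ v₂ v₁) w₂)) (src≢dst T) , refl ,
    ↭-trans (solve 4 (λ a b c d → a ⊕ ((c ⊕ d) ⊕ b) ⊜ (a ⊕ b) ⊕ (d ⊕ c)) ↭-refl p₁ q₁ q₂ p₂)
            (↭-reflexive (sym (cong₂ _++_ route₁ route₂)))
    where open EdgePerm using (solve; _⊕_; _⊜_)

  replaceByCycleInsertion : (C : Decomposition) {T : OpenWalk} {Ro : List OpenWalk} {Z : ClosedWalk} {Rc : List ClosedWalk} →
    opens C ↭ T ∷ Ro → closeds C ↭ Z ∷ Rc →
    (N : OpenWalk) → endpoints N ≡ endpoints T → route N ↭ route T ++ ClosedWalk.route Z →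
    Σ[ C′ ∈ Decomposition ] length (closeds C′) < length (closeds C) × allEndpoints (opens C′) ↭ allEndpoints (opens C)
  replaceByCycleInsertion C {T} {Ro} {Z} {Rc} os↭ cs↭ N ends≡ route↭ =
    record { opens = N ∷ Ro ; closeds = Rc ; partitions = ↭-trans edges↭ (partitions C) } ,
    ≤-reflexive (sym (↭-length cs↭)) ,
    ↭-trans (↭-reflexive (cong (_++ allEndpoints Ro) ends≡)) (concatMap-↭ endpoints (↭-sym os↭))
    where
    open PermutationReasoning
    open EdgePerm using (solve; _⊕_; _⊜_)
    edges↭ : openEdges (N ∷ Ro) ++ closedEdges Rc ↭ openEdges (opens C) ++ closedEdges (closeds C)
    edges↭ = begin
      (route N ++ openEdges Ro) ++ closedEdges Rc
        ↭⟨ ++⁺ʳ _ (++⁺ʳ _ route↭) ⟩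
      ((route T ++ ClosedWalk.route Z) ++ openEdges Ro) ++ closedEdges Rc
        ↭⟨ solve 4 (λ a b r c → ((a ⊕ b) ⊕ r) ⊕ c ⊜ (a ⊕ r) ⊕ (b ⊕ c)) ↭-refl
                   (route T) (ClosedWalk.route Z) (openEdges Ro) (closedEdges Rc) ⟩
      openEdges (T ∷ Ro) ++ closedEdges (Z ∷ Rc)
        ↭⟨ ++⁺ (concatMap-↭ route (↭-sym os↭)) (concatMap-↭ ClosedWalk.route (↭-sym cs↭)) ⟩
      openEdges (opens C) ++ closedEdges (closeds C) ∎

  exchangeTails : ∀ {w} T₁ T₂ → SplitAt (src T₁) (dst T₁) w (route T₁) → SplitAt (src T₂) (dst T₂) w (route T₂) →
    src T₁ ≢ dst T₂ → src T₂ ≢ dst T₁ →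
    Σ[ N₁ ∈ OpenWalk ] Σ[ N₂ ∈ OpenWalk ] src N₁ ≡ src T₁ × dst N₁ ≡ dst T₂ × (∀ R → N₁ ∷ N₂ ∷ R ≋ T₁ ∷ T₂ ∷ R)
  exchangeTails T₁ T₂ (splitAt p₁ q₁ route₁ w₁ w₂) (splitAt p₂ q₂ route₂ v₁ v₂) open₁ open₂ =
    openWalk (src T₁) (dst T₂) (p₁ ++ q₂) (walk-++ w₁ v₂) open₁ ,
    openWalk (src T₂) (dst T₁) (p₂ ++ q₁) (walk-++ v₁ w₂) open₂ ,
    refl , refl , λ R → mk≋ (endpoints↭ R) (edges↭ R)
    where
    endpoints↭ : ∀ R → src T₁ ∷ dst T₂ ∷ src T₂ ∷ dst T₁ ∷ allEndpoints R ↭ allEndpoints (T₁ ∷ T₂ ∷ R)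
    endpoints↭ R = solve 5 (λ a b c d e → a ⊕ (d ⊕ (c ⊕ (b ⊕ e))) ⊜ a ⊕ (b ⊕ (c ⊕ (d ⊕ e)))) ↭-refl
      [ src T₁ ] [ dst T₁ ] [ src T₂ ] [ dst T₂ ] (allEndpoints R)
      where open VertexPerm using (solve; _⊕_; _⊜_)
    edges↭ : ∀ R → (p₁ ++ q₂) ++ (p₂ ++ q₁) ++ openEdges R ↭ openEdges (T₁ ∷ T₂ ∷ R)
    edges↭ R = ↭-trans
      (solve 5 (λ a b c d r → (a ⊕ d) ⊕ ((c ⊕ b) ⊕ r) ⊜ (a ⊕ b) ⊕ ((c ⊕ d) ⊕ r)) ↭-refl p₁ q₁ p₂ q₂ (openEdges R))
      (↭-reflexive (cong₂ (λ r r′ → r ++ r′ ++ openEdges R) (sym route₁) (sym route₂)))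
      where open EdgePerm using (solve; _⊕_; _⊜_)

  side-cases : ∀ v → side v ≡ false ⊎ side v ≡ true
  side-cases v with side v
  ... | false = inj₁ refl
  ... | true = inj₂ refl

  XYWalk : OpenWalk → Set
  XYWalk T = side (src T) ≢ side (dst T)

  Within : Bool → OpenWalk → Set
  Within b T = side (src T) ≡ b × side (dst T) ≡ b

  XYWalk⊎split : ∀ os → Any XYWalk os ⊎
    Σ[ Xs ∈ List OpenWalk ] Σ[ Ys ∈ List OpenWalk ] os ↭ Xs ++ Ys × All (Within false) Xs × All (Within true) Ys
  XYWalk⊎split [] = inj₂ ([] , [] , ↭-refl , [] , [])
  XYWalk⊎split (T ∷ os) with side (src T) Bool.≟ side (dst T)
  ... | no xy = inj₁ (here xy)
  ... | yes same with XYWalk⊎split os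
  ... | inj₁ xy = inj₁ (there xy)
  ... | inj₂ (Xs , Ys , os↭ , inX , inY) with side-cases (src T)
  ... | inj₁ inX′ = inj₂ (T ∷ Xs , Ys , ↭-prep T os↭ , (inX′ , trans (sym same) inX′) ∷ inX , inY)
  ... | inj₂ inY′ =
    inj₂ (Xs , T ∷ Ys , ↭-trans (↭-prep T os↭) (↭-sym (shift T Xs Ys)) , inX , (inY′ , trans (sym same) inY′) ∷ inY)

  within⇒side : ∀ {b} os → All (Within b) os → ∀ {v} → v ∈ allEndpoints os → side v ≡ b
  within⇒side (T ∷ os) ((s , _) ∷ _) (here refl) = s
  within⇒side (T ∷ os) ((_ , d) ∷ _) (there (here refl)) = d
  within⇒side (T ∷ os) (_ ∷ inB) (there (there v∈)) = within⇒side os inB v∈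

  module _ (connected : Connected G) where

    absorbClosedWalk : (C : Decomposition) {v : Fin n} → v ∈ allEndpoints (opens C) →
      {f : Edge G} → f ∈ closedEdges (closeds C) →
      Σ[ C′ ∈ Decomposition ] length (closeds C′) < length (closeds C) × allEndpoints (opens C′) ↭ allEndpoints (opens C)
    absorbClosedWalk C v∈ {f} f∈ =
      let T , _ , os↭T , _ = select-concatMap endpoints (opens C) v∈
          w , atOpen , atClosed = meetingVertex (partitions C) (connected (src T) (endX f)) (edgeAtSrc os↭T) (f , f∈ , inj₁ refl)
          T₁ , Ro , os↭ , split₁ = splitOpenAt (opens C) atOpen
          Z , Rc , cs↭ , split₂ = splitClosedAt (closeds C) atClosed
          N , ends≡ , route↭ = insertCycle T₁ Z split₁ split₂
      in replaceByCycleInsertion C os↭ cs↭ N ends≡ route↭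

    absorbClosedWalks : ∀ k (C : Decomposition) → length (closeds C) < k → ∀ {v} → v ∈ allEndpoints (opens C) →
      Σ[ os ∈ List OpenWalk ] openEdges os ↭ allEdges × allEndpoints os ↭ allEndpoints (opens C)
    absorbClosedWalks (suc k) C (s≤s bound) v∈ = absorb ([]⊎∈ (closedEdges (closeds C)))
      where
      absorb : closedEdges (closeds C) ≡ [] ⊎ Σ[ f ∈ Edge G ] f ∈ closedEdges (closeds C) →
        Σ[ os ∈ List OpenWalk ] openEdges os ↭ allEdges × allEndpoints os ↭ allEndpoints (opens C)
      absorb (inj₁ none) =
        opens C , ↭-trans (↭-reflexive (sym (trans (cong (openEdges (opens C) ++_) none) (++-identityʳ _)))) (partitions C) , ↭-refl
      absorb (inj₂ (f , f∈)) =
        let C′ , shorter , ends↭ = absorbClosedWalk C v∈ f∈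
            os , covered , ends′↭ = absorbClosedWalks k C′ (<-≤-trans shorter bound) (∈-resp-↭ (↭-sym ends↭) v∈)
        in os , covered , ↭-trans ends′↭ ends↭

    exchangeAcrossSides : ∀ Xs Ys → All (Within false) Xs → All (Within true) Ys → openEdges Xs ++ openEdges Ys ↭ allEdges →
      ∀ {x y} → x ∈ allEndpoints Xs → y ∈ allEndpoints Ys → Σ[ os ∈ List OpenWalk ] os ≋ Xs ++ Ys × Any XYWalk os
    exchangeAcrossSides Xs Ys inX inY Xs++Ys↭ x∈ y∈ =
      let Tx , _ , Xs↭Tx , _ = select-concatMap endpoints Xs x∈
          Ty , _ , Ys↭Ty , _ = select-concatMap endpoints Ys y∈
          w , atX , atY = meetingVertex Xs++Ys↭ (connected (src Tx) (src Ty)) (edgeAtSrc Xs↭Tx) (edgeAtSrc Ys↭Ty)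
          T₁ , R₁ , Xs↭ , split₁ = splitOpenAt Xs atX
          T₂ , R₂ , Ys↭ , split₂ = splitOpenAt Ys atY
          s₁ , d₁ = All.head (All-resp-↭ Xs↭ inX)
          s₂ , d₂ = All.head (All-resp-↭ Ys↭ inY)
          N₁ , N₂ , src≡ , dst≡ , crossed =
            exchangeTails T₁ T₂ split₁ split₂ (opposite-sides⇒≢ s₁ d₂) (opposite-sides⇒≢ d₁ s₂ ∘ sym)
          regrouped = ↭⇒≋ (↭-trans (++⁺ Xs↭ Ys↭) (↭-prep T₁ (shift T₂ R₁ R₂)))
          N₁-xy = opposite-sides⇒side≢ (trans (cong side src≡) s₁) (trans (cong side dst≡) d₂)
      in N₁ ∷ N₂ ∷ R₁ ++ R₂ , ≋-trans (crossed (R₁ ++ R₂)) (≋-sym regrouped) , here N₁-xy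

    makeXYWalk : ∀ os → openEdges os ↭ allEdges → ∀ {x y} → x ∈ allEndpoints os → side x ≡ false →
      y ∈ allEndpoints os → side y ≡ true → Σ[ os′ ∈ List OpenWalk ] os′ ≋ os × Any XYWalk os′
    makeXYWalk os covered {x} {y} x∈ sx y∈ sy = [ (λ xy → os , ≋-refl , xy) , crossSides ]′ (XYWalk⊎split os)
      where
      crossSides : Σ[ Xs ∈ List OpenWalk ] Σ[ Ys ∈ List OpenWalk ]
          os ↭ Xs ++ Ys × All (Within false) Xs × All (Within true) Ys →
        Σ[ os′ ∈ List OpenWalk ] os′ ≋ os × Any XYWalk os′
      crossSides (Xs , Ys , os↭ , inX , inY) =
        let os′ , os′≋ , xy = exchangeAcrossSides Xs Ys inX inY Xs++Ys↭ x∈Xs y∈Ys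
        in os′ , ≋-trans os′≋ (≋-sym (↭⇒≋ os↭)) , xy
        where
        Xs++Ys↭ : openEdges Xs ++ openEdges Ys ↭ allEdges
        Xs++Ys↭ = ↭-trans (↭-reflexive (sym (concatMap-++ route Xs Ys))) (↭-trans (concatMap-↭ route (↭-sym os↭)) covered)
        split : ∀ {v} → v ∈ allEndpoints os → v ∈ allEndpoints Xs ⊎ v ∈ allEndpoints Ys
        split v∈ = ∈-++⁻ (allEndpoints Xs) (subst (_ ∈_) (concatMap-++ endpoints Xs Ys) (∈-resp-↭ (concatMap-↭ endpoints os↭) v∈))
        x∈Xs : x ∈ allEndpoints Xs
        x∈Xs = [ id , (λ x∈Ys → ⊥-elim (opposite-sides⇒side≢ sx (within⇒side Ys inY x∈Ys) refl)) ]′ (split x∈)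
        y∈Ys : y ∈ allEndpoints Ys
        y∈Ys = [ (λ y∈Xs → ⊥-elim (opposite-sides⇒side≢ (within⇒side Xs inX y∈Xs) sy refl)) , id ]′ (split y∈)

    odd⇒∈allEndpoints : ∀ os {v} → allEndpoints os ↭ Vodd G → degree G v % 2 ≡ 1 → v ∈ allEndpoints os
    odd⇒∈allEndpoints os {v} ends↭ odd = ∈-resp-↭ (↭-sym ends↭) (Equivalence.from (∈Vodd⇔odd v) odd)

    xyOpenDecomposition : OddOnBothSides G →
      Σ[ os ∈ List OpenWalk ] openEdges os ↭ allEdges × allEndpoints os ↭ Vodd G × Any XYWalk os
    xyOpenDecomposition (x , (sx , dx) , y , (sy , dy)) =
      let C , ends↭ = oddEndDecomposition
          os , covered , ends′↭ = absorbClosedWalks _ C ≤-refl (odd⇒∈allEndpoints (opens C) ends↭ dx)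
          os↭Vodd = ↭-trans ends′↭ ends↭
          os′ , mk≋ ends″↭ edges↭ , xy =
            makeXYWalk os covered (odd⇒∈allEndpoints os os↭Vodd dx) sx (odd⇒∈allEndpoints os os↭Vodd dy) sy
      in os′ , ↭-trans edges↭ covered , ↭-trans ends″↭ os↭Vodd , xy

  allEndpoints-length : ∀ os → length (allEndpoints os) ≡ length os * 2
  allEndpoints-length [] = refl
  allEndpoints-length (T ∷ os) = cong (2 +_) (allEndpoints-length os)

  toTrails : ∀ os → Unique (openEdges os) →
    Σ[ Ts ∈ List (OpenTrail G) ] concatMap OpenTrail.tedges Ts ≡ openEdges os × length Ts ≡ length os
      × (Any XYWalk os → Any (IsXYTrail G) Ts)
  toTrails [] _ = [] , refl , refl , λ ()
  toTrails (T ∷ os) unique =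
    let Ts , edges≡ , length≡ , xy = toTrails os (Unique-++⁻ʳ (route T) unique)
    in trail ∷ Ts , cong (route T ++_) edges≡ , cong suc length≡ , λ where
         (here xyT) → here xyT
         (there xyos) → there (xy xyos)
    where
    trail : OpenTrail G
    trail = record { start = src T ; end = dst T ; tedges = route T ; walk = walk T
                   ; distinct = Unique-++⁻ˡ (route T) unique ; open′ = src≢dst T }

lemma2p4 : {n : ℕ} (G : BipGraph n) → Connected G → OddOnBothSides G →
    Σ[ Ts ∈ List (OpenTrail G) ]
      (IsDecomposition G Ts × length Ts ≡ length (Vodd G) / 2 × Any (IsXYTrail G) Ts)
lemma2p4 G connected oddBoth =
  let os , covered , ends↭ , xy = xyOpenDecomposition G connected oddBoth
      Ts , edges≡ , length≡ , toXY = toTrails G os (Unique-resp-↭ (↭-sym covered) (Unique.allFin⁺ _))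
      half : length Ts ≡ length (Vodd G) / 2
      half = begin
        length Ts                             ≡⟨ length≡ ⟩
        length os                             ≡⟨ m*n/n≡m (length os) 2 ⟨
        length os * 2 / 2                     ≡⟨ cong (_/ 2) (allEndpoints-length G os) ⟨
        length (allEndpoints G os) / 2        ≡⟨ cong (_/ 2) (↭-length ends↭) ⟩
        length (Vodd G) / 2                   ∎
  in Ts , subst (_↭ _) (sym edges≡) covered , half , toXY xy
  where open ≡-Reasoning
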